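{- Let $\pi=\pi_1\cdots\pi_n$ be a permutation of $[n]$ with $n\ge2$, and let $G_\pi$ be its grid graph (defined in the context). The number of degree-$1$ vertices in the first column (vertices $(1,s)$) equals $\mathbf{1}_{\{\pi_1=1\}}+\mathbf{1}_{\{\pi_1>\pi_2\}}$, and the number of degree-$1$ vertices in the last column (vertices $(n,s)$) equals $\mathbf{1}_{\{\pi_n=1\}}+\mathbf{1}_{\{\pi_{n-1}<\pi_n\}}$.
   Context: The grid graph $G_\pi$ of a permutation $\pi=\pi_1\cdots\pi_n$ of $[n]$ has vertex set $\{(i,j):1\le i\le n,\ 1\le j\le \pi_i\}$; two vertices $(i,j),(i',j')$ are adjacent iff either $i=i'$ and $|j-j'|=1$, or $|i-i'|=1$ and $j=j'$. $\mathbf{1}_{\{A\}}$ is the indicator of $A$. -}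

module Defs where

open import Data.Nat using (ℕ; zero; suc; _≤_; ∣_-_∣) renaming (_≟_ to _≟ℕ_)
open import Data.Nat.Properties using (_≤?_)
open import Data.Fin using (Fin; toℕ)
import Data.Fin as Fin
open import Data.Fin.Permutation using (Permutation′; _⟨$⟩ʳ_)
open import Data.List using (List; []; _∷_; map; concatMap; upTo; filter; length)
open import Data.List using () renaming (allFin to allFinL)
open import Data.Product using (_×_; _,_; proj₁; proj₂)
open import Data.Sum using (_⊎_)
open import Data.Bool using (if_then_else_)
open import Relation.Nullary using (Dec; yes; no; does)
open import Relation.Nullary.Decidable using (_×-dec_; _⊎-dec_)
open import Relation.Binary.PropositionalEquality using (_≡_)

𝟙 : ∀ {a} {A : Set a} → Dec A → ℕ
𝟙 d = if does d then 1 else 0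

-- The value π_i ∈ [n] of a permutation of [n]; column indices are
-- Fin n, with Fin index i standing for column (toℕ i + 1).
val : ∀ {n} → Permutation′ n → Fin n → ℕ
val π i = suc (toℕ (π ⟨$⟩ʳ i))

-- Vertices of the grid graph: pairs (i , j) with i a column and j a row.
Vertex : ℕ → Set
Vertex n = Fin n × ℕ

rows : ℕ → List ℕ
rows k = map suc (upTo k)

vertices : ∀ {n} → Permutation′ n → List (Vertex n)
vertices {n} π = concatMap (λ i → map (λ j → (i , j)) (rows (val π i))) (allFinL n)

Adj : ∀ {n} → Vertex n → Vertex n → Set
Adj (i , j) (i′ , j′) =
  (toℕ i ≡ toℕ i′ × ∣ j - j′ ∣ ≡ 1) ⊎ (∣ toℕ i - toℕ i′ ∣ ≡ 1 × j ≡ j′)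

adj? : ∀ {n} (v w : Vertex n) → Dec (Adj v w)
adj? (i , j) (i′ , j′) =
  ((toℕ i ≟ℕ toℕ i′) ×-dec (∣ j - j′ ∣ ≟ℕ 1))
  ⊎-dec ((∣ toℕ i - toℕ i′ ∣ ≟ℕ 1) ×-dec (j ≟ℕ j′))

degree : ∀ {n} → Permutation′ n → Vertex n → ℕ
degree π v = length (filter (adj? v) (vertices π))

deg1InColumn : ∀ {n} → Permutation′ n → Fin n → ℕ
deg1InColumn π i = length (filter (λ s → degree π (i , s) ≟ℕ 1) (rows (val π i)))

{-# OPTIONS --safe #-}
-- In an end column of height a whose only neighbouring column has height b ≥ 1,
-- the vertex in row s has the vertical neighbours s ± 1 that lie in [1, a] and a
-- horizontal neighbour iff s ≤ b. A row s < a has the neighbour s + 1 and, besides,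
-- either s − 1 or (when s = 1) the horizontal neighbour, so it has degree ≥ 2.
-- Hence only the top row can have degree 1, and it does iff a = 1 or b < a; these
-- two cases are exclusive because b ≥ 1.
module Submission where

open import Defs
open import Data.Nat using (ℕ; zero; suc; _+_; _<_; _≟_; s≤s; z<s; ∣_-_∣)
open import Data.Nat.Properties
  using (_<?_; _≤?_; +-comm; +-suc; +-identityʳ; ≤-refl; ≤-trans; m≤n⇒m≤1+n; <⇒≤; >⇒≢; <⇒≱; ≰⇒>;
         <-cmp; n≮n; 0≢1+n; suc-injective; m≡n⇒∣m-n∣≡0; ∣-∣-comm)
open import Data.Nat.ListAction using (sum)
open import Data.Fin using (Fin; zero; suc; toℕ; fromℕ; inject₁)
open import Data.Fin.Permutation using (Permutation′; _⟨$⟩ʳ_)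
open import Data.Fin.Properties using (toℕ-fromℕ; toℕ-inject₁)
open import Data.List using (List; []; _∷_; [_]; _++_; map; concatMap; filter; length; upTo; tabulate; allFin)
open import Data.List.Properties using (filter-++; filter-≐; filter-none; length-++; upTo-∷ʳ; map-tabulate)
open import Data.List.Relation.Unary.All using (All; universal)
open import Data.List.Relation.Unary.All.Properties using (applyUpTo⁺₁)
open import Data.Bool using (true; false)
open import Data.Product using (_×_; _,_)
open import Data.Sum using (_⊎_; inj₁; inj₂)
import Data.Sum as Sum
open import Data.Empty using (⊥-elim)
open import Function using (id; _∘_)
open import Level using (Level)
open import Relation.Nullary using (Dec; yes; no; ¬_; does; contradiction)
open import Relation.Unary using (Pred; Decidable; _≐_; _∪_; _∩_; _⊆_; ∅; ∁)
open import Relation.Unary.Properties using (_∪?_)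
open import Relation.Binary.PropositionalEquality
  using (_≡_; refl; sym; trans; cong; cong₂; subst; module ≡-Reasoning)
open import Relation.Binary.Definitions using (tri<; tri≈; tri>)

open ≡-Reasoning

private variable
  a b p q : Level
  A : Set a
  B : Set b

𝟙-yes : (A? : Dec A) → A → 𝟙 A? ≡ 1
𝟙-yes (yes _) _ = refl
𝟙-yes (no ¬x) x = contradiction x ¬x

𝟙-no : (A? : Dec A) → ¬ A → 𝟙 A? ≡ 0
𝟙-no (yes x) ¬x = contradiction x ¬x
𝟙-no (no _)  _  = refl

𝟙-<-suc : ∀ r c → 𝟙 (r <? suc c) ≡ 𝟙 (r <? c) + 𝟙 (c ≟ r)
𝟙-<-suc r c with <-cmp r c
... | tri< r<c r≢c _ = trans (𝟙-yes (r <? suc c) (m≤n⇒m≤1+n r<c))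
                         (sym (cong₂ _+_ (𝟙-yes (r <? c) r<c) (𝟙-no (c ≟ r) (r≢c ∘ sym))))
... | tri≈ _ refl _  = trans (𝟙-yes (r <? suc r) ≤-refl)
                         (sym (cong₂ _+_ (𝟙-no (r <? r) (n≮n r)) (𝟙-yes (r ≟ r) refl)))
... | tri> _ r≢c c<r = trans (𝟙-no (r <? suc c) (λ { (s≤s r≤c) → <⇒≱ c<r r≤c }))
                         (sym (cong₂ _+_ (𝟙-no (r <? c) (<⇒≱ c<r ∘ <⇒≤)) (𝟙-no (c ≟ r) (r≢c ∘ sym))))

count : {P : Pred A p} → Decidable P → List A → ℕ
count P? xs = length (filter P? xs)

count-singleton : {P : Pred A p} (P? : Decidable P) (x : A) → count P? [ x ] ≡ 𝟙 (P? x)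
count-singleton P? x with does (P? x)
... | true  = refl
... | false = refl

count-++ : {P : Pred A p} (P? : Decidable P) (xs ys : List A) →
           count P? (xs ++ ys) ≡ count P? xs + count P? ys
count-++ P? xs ys = trans (cong length (filter-++ P? xs ys)) (length-++ (filter P? xs))

count-map : {P : Pred B p} (P? : Decidable P) (f : A → B) (xs : List A) →
            count P? (map f xs) ≡ count (P? ∘ f) xs
count-map P? f []       = refl
count-map P? f (x ∷ xs) with does (P? (f x))
... | true  = cong suc (count-map P? f xs)
... | false = count-map P? f xs

count-concatMap : {P : Pred B p} (P? : Decidable P) (f : A → List B) (xs : List A) →
                  count P? (concatMap f xs) ≡ sum (map (count P? ∘ f) xs)
count-concatMap P? f []       = refl
count-concatMap P? f (x ∷ xs) =
  trans (count-++ P? (f x) (concatMap f xs)) (cong (count P? (f x) +_) (count-concatMap P? f xs))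

count-≐ : {P : Pred A p} {Q : Pred A q} (P? : Decidable P) (Q? : Decidable Q) → P ≐ Q →
          (xs : List A) → count P? xs ≡ count Q? xs
count-≐ P? Q? P≐Q xs = cong length (filter-≐ P? Q? P≐Q xs)

count-none : {P : Pred A p} (P? : Decidable P) {xs : List A} → All (∁ P) xs → count P? xs ≡ 0
count-none P? none = cong length (filter-none P? none)

count-∪ : {P : Pred A p} {Q : Pred A q} (P? : Decidable P) (Q? : Decidable Q) → P ∩ Q ⊆ ∅ →
          (xs : List A) → count (P? ∪? Q?) xs ≡ count P? xs + count Q? xs
count-∪ P? Q? disjoint []       = refl
count-∪ P? Q? disjoint (x ∷ xs) with P? x | Q? x | count-∪ P? Q? disjoint xs
... | yes px | yes qx | _  = ⊥-elim (disjoint (px , qx))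
... | yes _  | no _   | eq = cong suc eq
... | no _   | yes _  | eq = trans (cong suc eq) (sym (+-suc (count P? xs) (count Q? xs)))
... | no _   | no _   | eq = eq

count-upTo-∷ʳ : {P : Pred ℕ p} (P? : Decidable P) (c : ℕ) →
                count P? (upTo (suc c)) ≡ count P? (upTo c) + 𝟙 (P? c)
count-upTo-∷ʳ P? c = begin
  count P? (upTo (suc c))          ≡⟨ cong (count P?) (sym (upTo-∷ʳ c)) ⟩
  count P? (upTo c ++ [ c ])       ≡⟨ count-++ P? (upTo c) [ c ] ⟩
  count P? (upTo c) + count P? [ c ] ≡⟨ cong (count P? (upTo c) +_) (count-singleton P? c) ⟩
  count P? (upTo c) + 𝟙 (P? c)     ∎

count-upTo-≟ : ∀ r c → count (_≟ r) (upTo c) ≡ 𝟙 (r <? c)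
count-upTo-≟ r zero    = refl
count-upTo-≟ r (suc c) = begin
  count (_≟ r) (upTo (suc c))        ≡⟨ count-upTo-∷ʳ (_≟ r) c ⟩
  count (_≟ r) (upTo c) + 𝟙 (c ≟ r)  ≡⟨ cong (_+ 𝟙 (c ≟ r)) (count-upTo-≟ r c) ⟩
  𝟙 (r <? c) + 𝟙 (c ≟ r)             ≡⟨ 𝟙-<-suc r c ⟨
  𝟙 (r <? suc c)                     ∎

count-upTo-suc≟ : ∀ {t c} → t < c → count (λ j → suc j ≟ t) (upTo c) ≡ 𝟙 (0 <? t)
count-upTo-suc≟ {zero}  {c} _   = count-none (λ j → suc j ≟ 0) (universal (λ _ ()) (upTo c))
count-upTo-suc≟ {suc t} {c} t<c = begin
  count (λ j → suc j ≟ suc t) (upTo c)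
    ≡⟨ count-≐ (λ j → suc j ≟ suc t) (_≟ t) (suc-injective , cong suc) (upTo c) ⟩
  count (_≟ t) (upTo c)                ≡⟨ count-upTo-≟ t c ⟩
  𝟙 (t <? c)                           ≡⟨ 𝟙-yes (t <? c) (<⇒≤ t<c) ⟩
  1                                    ∎

∣n-1+n∣≡1 : ∀ n → ∣ n - suc n ∣ ≡ 1
∣n-1+n∣≡1 zero    = refl
∣n-1+n∣≡1 (suc n) = ∣n-1+n∣≡1 n

∣m-n∣≡1⇒ : ∀ {m n} → ∣ m - n ∣ ≡ 1 → suc n ≡ m ⊎ n ≡ suc m
∣m-n∣≡1⇒ {zero}  {n}     eq = inj₂ eq
∣m-n∣≡1⇒ {suc m} {zero}  eq = inj₁ (sym eq)
∣m-n∣≡1⇒ {suc m} {suc n} eq = Sum.map (cong suc) (cong suc) (∣m-n∣≡1⇒ eq)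

∣m-n∣≡1⇐ : ∀ {m n} → suc n ≡ m ⊎ n ≡ suc m → ∣ m - n ∣ ≡ 1
∣m-n∣≡1⇐ {n = n} (inj₁ refl) = trans (∣-∣-comm (suc n) n) (∣n-1+n∣≡1 n)
∣m-n∣≡1⇐ {m = m} (inj₂ refl) = ∣n-1+n∣≡1 m

count-upTo-∣-∣≡1 : ∀ {t c} → t < c →
  count (λ j → ∣ t - j ∣ ≟ 1) (upTo c) ≡ 𝟙 (0 <? t) + 𝟙 (suc t <? c)
count-upTo-∣-∣≡1 {t} {c} t<c = begin
  count (λ j → ∣ t - j ∣ ≟ 1) (upTo c)
    ≡⟨ count-≐ (λ j → ∣ t - j ∣ ≟ 1) below∪above (∣m-n∣≡1⇒ , ∣m-n∣≡1⇐) (upTo c) ⟩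
  count below∪above (upTo c)
    ≡⟨ count-∪ (λ j → suc j ≟ t) (_≟ suc t) (λ { (refl , ()) }) (upTo c) ⟩
  count (λ j → suc j ≟ t) (upTo c) + count (_≟ suc t) (upTo c)
    ≡⟨ cong₂ _+_ (count-upTo-suc≟ t<c) (count-upTo-≟ (suc t) c) ⟩
  𝟙 (0 <? t) + 𝟙 (suc t <? c) ∎
  where
  below∪above : Decidable ((λ j → suc j ≡ t) ∪ (_≡ suc t))
  below∪above = (λ j → suc j ≟ t) ∪? (_≟ suc t)

neighboursInColumn : ∀ {n} → Vertex n → Fin n → ℕ → ℕ
neighboursInColumn v k c = count (adj? v) (map (k ,_) (rows c))

degree≡sum-neighboursInColumn : ∀ {n} (π : Permutation′ n) (v : Vertex n) →
  degree π v ≡ sum (tabulate (λ k → neighboursInColumn v k (val π k)))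
degree≡sum-neighboursInColumn {n} π v =
  trans (count-concatMap (adj? v) (λ k → map (k ,_) (rows (val π k))) (allFin n))
        (cong sum (map-tabulate id (λ k → neighboursInColumn v k (val π k))))

neighboursInColumn-upTo : ∀ {n} (i k : Fin n) s c →
  neighboursInColumn (i , s) k c ≡ count (λ j → adj? (i , s) (k , suc j)) (upTo c)
neighboursInColumn-upTo i k s c =
  trans (count-map (adj? (i , s)) (k ,_) (rows c))
        (count-map (λ j → adj? (i , s) (k , j)) suc (upTo c))

neighboursInColumn-same : ∀ {n} (i k : Fin n) t c → toℕ i ≡ toℕ k →
  neighboursInColumn (i , suc t) k c ≡ count (λ j → ∣ t - j ∣ ≟ 1) (upTo c)
neighboursInColumn-same i k t c i≡k =
  trans (neighboursInColumn-upTo i k (suc t) c)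
        (count-≐ (λ j → adj? (i , suc t) (k , suc j)) (λ j → ∣ t - j ∣ ≟ 1)
                 (vertical , inj₁ ∘ (i≡k ,_)) (upTo c))
  where
  vertical : ∀ {j} → Adj (i , suc t) (k , suc j) → ∣ t - j ∣ ≡ 1
  vertical (inj₁ (_ , d)) = d
  vertical (inj₂ (d , _)) = ⊥-elim (0≢1+n (trans (sym (m≡n⇒∣m-n∣≡0 i≡k)) d))

neighboursInColumn-adjacent : ∀ {n} (i k : Fin n) t c → ∣ toℕ i - toℕ k ∣ ≡ 1 →
  neighboursInColumn (i , suc t) k c ≡ 𝟙 (t <? c)
neighboursInColumn-adjacent i k t c ∣i-k∣≡1 = begin
  neighboursInColumn (i , suc t) k c ≡⟨ neighboursInColumn-upTo i k (suc t) c ⟩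
  count (λ j → adj? (i , suc t) (k , suc j)) (upTo c)
    ≡⟨ count-≐ (λ j → adj? (i , suc t) (k , suc j)) (_≟ t)
               (horizontal , λ j≡t → inj₂ (∣i-k∣≡1 , cong suc (sym j≡t))) (upTo c) ⟩
  count (_≟ t) (upTo c) ≡⟨ count-upTo-≟ t c ⟩
  𝟙 (t <? c) ∎
  where
  horizontal : ∀ {j} → Adj (i , suc t) (k , suc j) → j ≡ t
  horizontal (inj₁ (i≡k , _)) = ⊥-elim (0≢1+n (trans (sym (m≡n⇒∣m-n∣≡0 i≡k)) ∣i-k∣≡1))
  horizontal (inj₂ (_ , e))   = sym (suc-injective e)

neighboursInColumn-far : ∀ {n} (i k : Fin n) s c → 1 < ∣ toℕ i - toℕ k ∣ →
  neighboursInColumn (i , s) k c ≡ 0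
neighboursInColumn-far i k s c far =
  trans (neighboursInColumn-upTo i k s c)
        (count-none (λ j → adj? (i , s) (k , suc j)) (universal (λ _ → notAdj) (upTo c)))
  where
  notAdj : ∀ {j} → ¬ Adj (i , s) (k , j)
  notAdj (inj₁ (i≡k , _)) = >⇒≢ (≤-trans z<s far) (m≡n⇒∣m-n∣≡0 i≡k)
  notAdj (inj₂ (d , _))   = >⇒≢ far d

sum-tabulate-zero : ∀ {n} (f : Fin n → ℕ) → (∀ k → f k ≡ 0) → sum (tabulate f) ≡ 0
sum-tabulate-zero {zero}  f vanish = refl
sum-tabulate-zero {suc n} f vanish =
  cong₂ _+_ (vanish zero) (sum-tabulate-zero (f ∘ suc) (vanish ∘ suc))

sum-tabulate-lastTwo : ∀ m (f : Fin (suc (suc m)) → ℕ) → (∀ k → toℕ k < m → f k ≡ 0) →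
  sum (tabulate f) ≡ f (inject₁ (fromℕ m)) + f (fromℕ (suc m))
sum-tabulate-lastTwo zero    f vanish = cong (f zero +_) (+-identityʳ (f (suc zero)))
sum-tabulate-lastTwo (suc m) f vanish =
  cong₂ _+_ (vanish zero z<s) (sum-tabulate-lastTwo m (f ∘ suc) (λ k → vanish (suc k) ∘ s≤s))

m<n⇒1<∣1+n-m∣ : ∀ {m n} → m < n → 1 < ∣ suc n - m ∣
m<n⇒1<∣1+n-m∣ {zero}  {suc n} _         = s≤s z<s
m<n⇒1<∣1+n-m∣ {suc m} {suc n} (s≤s m<n) = m<n⇒1<∣1+n-m∣ m<n

-- Rows are 0-based here: t stands for row suc t of an end column of height a
-- whose neighbouring column has height b.
endColumnDegree : ℕ → ℕ → ℕ → ℕ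
endColumnDegree a b t = count (λ j → ∣ t - j ∣ ≟ 1) (upTo a) + 𝟙 (t <? b)

degree-firstColumn : ∀ {m} (π : Permutation′ (suc (suc m))) t →
  degree π (zero , suc t) ≡ endColumnDegree (val π zero) (val π (suc zero)) t
degree-firstColumn {m} π t = begin
  degree π (zero , suc t)
    ≡⟨ degree≡sum-neighboursInColumn π (zero , suc t) ⟩
  g zero + (g (suc zero) + sum (tabulate (λ k → g (suc (suc k)))))
    ≡⟨ cong (λ r → g zero + (g (suc zero) + r))
            (sum-tabulate-zero (λ k → g (suc (suc k))) (λ k → vanish (suc (suc k)) (s≤s z<s))) ⟩
  g zero + (g (suc zero) + 0)
    ≡⟨ cong₂ _+_ (neighboursInColumn-same zero zero t (val π zero) refl)
                 (trans (+-identityʳ _)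
                        (neighboursInColumn-adjacent zero (suc zero) t (val π (suc zero)) refl)) ⟩
  endColumnDegree (val π zero) (val π (suc zero)) t ∎
  where
  g : Fin (suc (suc m)) → ℕ
  g k = neighboursInColumn (zero , suc t) k (val π k)
  vanish : ∀ k → 1 < toℕ k → g k ≡ 0
  vanish k = neighboursInColumn-far zero k (suc t) (val π k)

degree-lastColumn : ∀ {m} (π : Permutation′ (suc (suc m))) t →
  degree π (fromℕ (suc m) , suc t)
    ≡ endColumnDegree (val π (fromℕ (suc m))) (val π (inject₁ (fromℕ m))) t
degree-lastColumn {m} π t = begin
  degree π (last , suc t)   ≡⟨ degree≡sum-neighboursInColumn π (last , suc t) ⟩
  sum (tabulate g)
    ≡⟨ sum-tabulate-lastTwo m g (λ k k<m → neighboursInColumn-far last k (suc t) (val π k) (far k<m)) ⟩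
  g penultimate + g last    ≡⟨ +-comm (g penultimate) (g last) ⟩
  g last + g penultimate
    ≡⟨ cong₂ _+_ (neighboursInColumn-same last last t (val π last) refl)
                 (neighboursInColumn-adjacent last penultimate t (val π penultimate) last-penultimate) ⟩
  endColumnDegree (val π last) (val π penultimate) t ∎
  where
  last penultimate : Fin (suc (suc m))
  last        = fromℕ (suc m)
  penultimate = inject₁ (fromℕ m)
  g : Fin (suc (suc m)) → ℕ
  g k = neighboursInColumn (last , suc t) k (val π k)
  far : ∀ {k} → toℕ k < m → 1 < ∣ toℕ last - toℕ k ∣
  far {k} k<m = subst (λ l → 1 < ∣ l - toℕ k ∣) (sym (toℕ-fromℕ (suc m))) (m<n⇒1<∣1+n-m∣ k<m)
  last-penultimate : ∣ toℕ last - toℕ penultimate ∣ ≡ 1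
  last-penultimate rewrite toℕ-fromℕ (suc m) | toℕ-inject₁ (fromℕ m) | toℕ-fromℕ m =
    ∣m-n∣≡1⇐ {suc m} {m} (inj₁ refl)

endColumnDegree-belowTop : ∀ {t a} b → t < a → 1 < endColumnDegree (suc a) (suc b) t
endColumnDegree-belowTop {t} {a} b t<a = subst (1 <_) (sym degree≡) (atLeastTwo t)
  where
  degree≡ : endColumnDegree (suc a) (suc b) t ≡ 𝟙 (0 <? t) + 1 + 𝟙 (t <? suc b)
  degree≡ = cong (_+ 𝟙 (t <? suc b))
    (trans (count-upTo-∣-∣≡1 (m≤n⇒m≤1+n t<a))
           (cong (𝟙 (0 <? t) +_) (𝟙-yes (suc t <? suc a) (s≤s t<a))))
  atLeastTwo : ∀ u → 1 < 𝟙 (0 <? u) + 1 + 𝟙 (u <? suc b)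
  atLeastTwo zero    = ≤-refl
  atLeastTwo (suc u) = s≤s z<s

endColumnDegree-top : ∀ a b →
  𝟙 (endColumnDegree (suc a) (suc b) a ≟ 1) ≡ 𝟙 (suc a ≟ 1) + 𝟙 (suc b <? suc a)
endColumnDegree-top a b = begin
  𝟙 (endColumnDegree (suc a) (suc b) a ≟ 1)
    ≡⟨ cong (λ d → 𝟙 (d + 𝟙 (a <? suc b) ≟ 1))
            (trans (count-upTo-∣-∣≡1 {a} ≤-refl)
                   (cong (𝟙 (0 <? a) +_) (𝟙-no (suc a <? suc a) (n≮n (suc a))))) ⟩
  𝟙 (𝟙 (0 <? a) + 0 + 𝟙 (a <? suc b) ≟ 1)
    ≡⟨ top a ⟩
  𝟙 (suc a ≟ 1) + 𝟙 (suc b <? suc a) ∎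
  where
  top : ∀ n → 𝟙 (𝟙 (0 <? n) + 0 + 𝟙 (n <? suc b) ≟ 1) ≡ 𝟙 (suc n ≟ 1) + 𝟙 (suc b <? suc n)
  top zero = refl
  top (suc n) with b ≤? n
  ... | yes b≤n = trans (cong (λ x → 𝟙 (suc x ≟ 1))
                              (𝟙-no (suc n <? suc b) (λ { (s≤s n<b) → <⇒≱ n<b b≤n })))
                        (sym (𝟙-yes (suc b <? suc (suc n)) (s≤s (s≤s b≤n))))
  ... | no b≰n  = trans (cong (λ x → 𝟙 (suc x ≟ 1)) (𝟙-yes (suc n <? suc b) (s≤s (≰⇒> b≰n))))
                        (sym (𝟙-no (suc b <? suc (suc n)) (λ { (s≤s (s≤s b≤n)) → b≰n b≤n })))

count-endColumnDegree≡1 : ∀ a b →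
  count (λ t → endColumnDegree (suc a) (suc b) t ≟ 1) (upTo (suc a))
    ≡ 𝟙 (suc a ≟ 1) + 𝟙 (suc b <? suc a)
count-endColumnDegree≡1 a b = begin
  count degree≡1? (upTo (suc a))         ≡⟨ count-upTo-∷ʳ degree≡1? a ⟩
  count degree≡1? (upTo a) + 𝟙 (degree≡1? a)
    ≡⟨ cong₂ _+_ (count-none degree≡1? (applyUpTo⁺₁ id a (>⇒≢ ∘ endColumnDegree-belowTop b)))
                 (endColumnDegree-top a b) ⟩
  𝟙 (suc a ≟ 1) + 𝟙 (suc b <? suc a)     ∎
  where
  degree≡1? : Decidable (λ t → endColumnDegree (suc a) (suc b) t ≡ 1)
  degree≡1? t = endColumnDegree (suc a) (suc b) t ≟ 1

deg1InColumn-endColumn : ∀ {n} (π : Permutation′ n) (e e′ : Fin n) →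
  (∀ t → degree π (e , suc t) ≡ endColumnDegree (val π e) (val π e′) t) →
  deg1InColumn π e ≡ 𝟙 (val π e ≟ 1) + 𝟙 (val π e′ <? val π e)
deg1InColumn-endColumn π e e′ degree≡ = begin
  deg1InColumn π e
    ≡⟨ count-map (λ s → degree π (e , s) ≟ 1) suc (upTo (val π e)) ⟩
  count (λ t → degree π (e , suc t) ≟ 1) (upTo (val π e))
    ≡⟨ count-≐ (λ t → degree π (e , suc t) ≟ 1) (λ t → endColumnDegree (val π e) (val π e′) t ≟ 1)
               ((λ {t} → subst (_≡ 1) (degree≡ t)) , (λ {t} → subst (_≡ 1) (sym (degree≡ t))))
               (upTo (val π e)) ⟩
  count (λ t → endColumnDegree (val π e) (val π e′) t ≟ 1) (upTo (val π e))
    ≡⟨ count-endColumnDegree≡1 (toℕ (π ⟨$⟩ʳ e)) (toℕ (π ⟨$⟩ʳ e′)) ⟩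
  𝟙 (val π e ≟ 1) + 𝟙 (val π e′ <? val π e) ∎

lemma6p1 : (m : ℕ) (π : Permutation′ (suc (suc m))) →
    (deg1InColumn π zero
       ≡ 𝟙 (val π zero ≟ 1) + 𝟙 (val π (suc zero) <? val π zero))
    × (deg1InColumn π (fromℕ (suc m))
       ≡ 𝟙 (val π (fromℕ (suc m)) ≟ 1)
         + 𝟙 (val π (inject₁ (fromℕ m)) <? val π (fromℕ (suc m))))
lemma6p1 m π =
    deg1InColumn-endColumn π zero (suc zero) (degree-firstColumn π)
  , deg1InColumn-endColumn π (fromℕ (suc m)) (inject₁ (fromℕ m)) (degree-lastColumn π)
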